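{- Let $n,g$ be integers with $0\leq g\leq \left\lfloor \frac{n-3}{2}\right\rfloor$. If $G$ is a connected graph of order $n$ that has an $R_g$-cutset, then $$1\leq \kappa_g(G)\leq n-2g-2.$$ Moreover, both bounds are sharp: there exist connected graphs $G_1,G_2$ of order $n$ with $\kappa_g(G_1)=1$ and $\kappa_g(G_2)=n-2g-2$.
   Context: A set $S$ of vertices is a cutset if $G-S$ is disconnected; for a non-negative integer $g$, a cutset is an $R_g$-cutset if every component of $G-S$ has at least $g+1$ vertices. If $G$ has an $R_g$-cutset, $\kappa_g(G)$ is the minimum cardinality of an $R_g$-cutset of $G$. -}

module Defs where

open import Data.Nat using (ℕ; suc; _≤_)
open import Data.Fin using (Fin)
open import Data.Fin.Subset using (Subset; _∈_; _∉_; ⊥; ∣_∣)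
open import Data.Product using (Σ; _×_; ∃)
open import Relation.Nullary using (¬_)
open import Relation.Binary.PropositionalEquality using (_≡_)
open import Function.Definitions using (Injective)

record Graph (n : ℕ) : Set₁ where
  field
    Adj   : Fin n → Fin n → Set
    sym   : ∀ {u v} → Adj u v → Adj v u
    irrefl : ∀ {u} → ¬ Adj u u
open Graph public

-- Reach G S u v : there is a walk from u to v in G - S
-- (all vertices of the walk lie outside S).
data Reach {n : ℕ} (G : Graph n) (S : Subset n) : Fin n → Fin n → Set where
  here : ∀ {u} → u ∉ S → Reach G S u u
  step : ∀ {u w v} → u ∉ S → Adj G u w → Reach G S w v → Reach G S u v

Connected : ∀ {n} → Graph n → Set
Connected G = ∀ u v → Reach G ⊥ u v

IsCutset : ∀ {n} → Graph n → Subset n → Set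
IsCutset G S = Σ _ λ u → Σ _ λ v → u ∉ S × v ∉ S × ¬ Reach G S u v

ComponentAtLeast : ∀ {n} → Graph n → Subset n → Fin n → ℕ → Set
ComponentAtLeast {n} G S v m =
  Σ (Fin m → Fin n) λ f → Injective _≡_ _≡_ f × (∀ i → Reach G S v (f i))

IsRgCutset : ∀ {n} → Graph n → ℕ → Subset n → Set
IsRgCutset G g S = IsCutset G S × (∀ v → v ∉ S → ComponentAtLeast G S v (suc g))

HasRgCutset : ∀ {n} → Graph n → ℕ → Set
HasRgCutset G g = ∃ λ S → IsRgCutset G g S

IsKappa : ∀ {n} → Graph n → ℕ → ℕ → Set
IsKappa G g k = (∃ λ S → IsRgCutset G g S × ∣ S ∣ ≡ k)
              × (∀ S → IsRgCutset G g S → k ≤ ∣ S ∣)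

-- Every cutset of a connected graph is nonempty, and an R_g-cutset S leaves two components of at
-- least g + 1 vertices each, so |S| ≤ n − 2g − 2. For sharpness take (K_{g+1} ∪ K_{b−g−1}) ∨ K_{n−b}:
-- a cutset must contain every universal vertex, and removing exactly those leaves the two cliques,
-- so κ_g = n − b; the choices b = n − 1 and b = 2g + 2 attain both bounds.
module Submission where

open import Defs
open import Data.Nat using (ℕ; suc; _≤_; _<_; _+_; _*_; _∸_; z≤n; s≤s; z<s)
open import Data.Nat.Properties
  using (≤-refl; ≤-trans; ≤-reflexive; <-trans; <-≤-trans; ≤-<-trans; <⇒≤; <⇒≱; ≰⇒>; ≮⇒≥
        ; <-irrefl; ≤-antisym; m<m+n
        ; m≤m+n; m≤n+m; +-monoʳ-<; +-comm; +-assoc; +-suc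
        ; m+n≤o⇒m≤o∸n; m≤o∸n⇒m+n≤o; m+[n∸m]≡n; ∸-+-assoc; ∸-monoʳ-<; m∸[m∸n]≡n
        ; _≤?_; _<?_)
open import Data.Nat.Solver using (module +-*-Solver)
open import Data.Fin using (Fin; zero; suc; toℕ; fromℕ<; inject≤; _↑ʳ_; splitAt; join)
open import Data.Fin.Properties
  using (toℕ<n; toℕ-fromℕ<; toℕ-inject≤; toℕ-↑ʳ; inject≤-injective; ↑ʳ-injective
        ; join-splitAt; injective⇒≤; suc-injective; _≟_)
open import Data.Fin.Subset using (Subset; ⊥; _∈_; _∉_; _⊆_; ∁; ∣_∣; Nonempty; inside; outside)
open import Data.Fin.Subset.Properties
  using (_∈?_; ∉⊥; ∣p∣≤n; ∣∁p∣≡n∸∣p∣; x∉p⇒x∈∁p; p⊆q⇒∣p∣≤∣q∣; ∣⁅x⁆∣≡1; x∈⁅y⁆⇒x≡y)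
open import Data.Vec using (_∷_; here; there; tabulate)
open import Data.Vec.Properties using (lookup∘tabulate; lookup⇒[]=; []=⇒lookup)
open import Data.Product using (Σ; _×_; _,_)
open import Data.Sum using (_⊎_; inj₁; inj₂; [_,_]′)
open import Function using (_∘_)
open import Function.Definitions using (Injective)
open import Relation.Nullary using (yes; no; does; contradiction)
open import Relation.Nullary.Decidable using (dec-true)
open import Relation.Unary using (Pred; Decidable)
open import Relation.Binary.PropositionalEquality using (_≡_; _≢_; refl; cong; subst; trans)
import Relation.Binary.PropositionalEquality as ≡

module _ {n} {G : Graph n} {S : Subset n} where

  reach-source∉ : ∀ {u v} → Reach G S u v → u ∉ S
  reach-source∉ (here u∉) = u∉
  reach-source∉ (step u∉ _ _) = u∉

  reach-target∉ : ∀ {u v} → Reach G S u v → v ∉ S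
  reach-target∉ (here v∉) = v∉
  reach-target∉ (step _ _ r) = reach-target∉ r

  reach-trans : ∀ {u v w} → Reach G S u v → Reach G S v w → Reach G S u w
  reach-trans (here _) r = r
  reach-trans (step u∉ e r) r′ = step u∉ e (reach-trans r r′)

  reach-snoc : ∀ {u v w} → Reach G S u v → Adj G v w → w ∉ S → Reach G S u w
  reach-snoc r e w∉ = reach-trans r (step (reach-target∉ r) e (here w∉))

  reach-sym : ∀ {u v} → Reach G S u v → Reach G S v u
  reach-sym (here u∉) = here u∉
  reach-sym (step u∉ e r) = reach-snoc (reach-sym r) (Graph.sym G e) u∉

  reach⊥⇒reach⊎nonempty : ∀ {u v} → Reach G ⊥ u v → Reach G S u v ⊎ Nonempty S
  reach⊥⇒reach⊎nonempty {u} r with u ∈? S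
  ... | yes u∈ = inj₂ (u , u∈)
  reach⊥⇒reach⊎nonempty (here _) | no u∉ = inj₁ (here u∉)
  reach⊥⇒reach⊎nonempty (step _ e r) | no u∉ with reach⊥⇒reach⊎nonempty r
  ... | inj₁ r′ = inj₁ (step u∉ e r′)
  ... | inj₂ ne = inj₂ ne

cutset-nonempty : ∀ {n} (G : Graph n) {S} → Connected G → IsCutset G S → Nonempty S
cutset-nonempty G con (u , v , _ , _ , ¬r) with reach⊥⇒reach⊎nonempty (con u v)
... | inj₁ r = contradiction r ¬r
... | inj₂ ne = ne

rank : ∀ {n} (p : Subset n) {i} → i ∈ p → Fin ∣ p ∣
rank (inside ∷ p) here = zero
rank (inside ∷ p) (there i∈) = suc (rank p i∈)
rank (outside ∷ p) (there i∈) = rank p i∈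

rank-injective : ∀ {n} (p : Subset n) {i j} (i∈ : i ∈ p) (j∈ : j ∈ p) →
                 rank p i∈ ≡ rank p j∈ → i ≡ j
rank-injective (inside ∷ p) here here _ = refl
rank-injective (inside ∷ p) (there i∈) (there j∈) eq = cong suc (rank-injective p i∈ j∈ (suc-injective eq))
rank-injective (outside ∷ p) (there i∈) (there j∈) eq = cong suc (rank-injective p i∈ j∈ eq)

injection-into⇒≤∣p∣ : ∀ {k n} (p : Subset n) {f : Fin k → Fin n} →
                      Injective _≡_ _≡_ f → (∀ i → f i ∈ p) → k ≤ ∣ p ∣
injection-into⇒≤∣p∣ p f-inj f∈ = injective⇒≤ (λ eq → f-inj (rank-injective p (f∈ _) (f∈ _) eq))

nonempty⇒1≤∣p∣ : ∀ {n} {p : Subset n} → Nonempty p → 1 ≤ ∣ p ∣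
nonempty⇒1≤∣p∣ {p = p} (x , x∈) =
  subst (_≤ ∣ p ∣) (∣⁅x⁆∣≡1 x)
    (p⊆q⇒∣p∣≤∣q∣ (λ y∈ → subst (_∈ p) (≡.sym (x∈⁅y⁆⇒x≡y x y∈)) x∈))

disjoint-injections⇒+≤∣p∣ : ∀ {a b n} (p : Subset n) {f : Fin a → Fin n} {h : Fin b → Fin n} →
  Injective _≡_ _≡_ f → Injective _≡_ _≡_ h → (∀ i j → f i ≢ h j) →
  (∀ i → f i ∈ p) → (∀ j → h j ∈ p) → a + b ≤ ∣ p ∣
disjoint-injections⇒+≤∣p∣ {a} {b} p {f} {h} f-inj h-inj disjoint f∈ h∈ =
  injection-into⇒≤∣p∣ p {[ f , h ]′ ∘ splitAt a}
    (splitAt-injective ∘ copair-injective) (copair∈ ∘ splitAt a)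
  where
  copair-injective : ∀ {x y} → [ f , h ]′ x ≡ [ f , h ]′ y → x ≡ y
  copair-injective {inj₁ i} {inj₁ j} eq = cong inj₁ (f-inj eq)
  copair-injective {inj₂ i} {inj₂ j} eq = cong inj₂ (h-inj eq)
  copair-injective {inj₁ i} {inj₂ j} eq = contradiction eq (disjoint i j)
  copair-injective {inj₂ i} {inj₁ j} eq = contradiction (≡.sym eq) (disjoint j i)
  copair∈ : ∀ x → [ f , h ]′ x ∈ p
  copair∈ (inj₁ i) = f∈ i
  copair∈ (inj₂ j) = h∈ j
  splitAt-injective : ∀ {x y} → splitAt a {b} x ≡ splitAt a y → x ≡ y
  splitAt-injective {x} {y} eq =
    trans (≡.sym (join-splitAt a b x)) (trans (cong (join a b) eq) (join-splitAt a b y))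

≤∣∁p∣⇒∣p∣≤n∸ : ∀ {k n} (p : Subset n) → k ≤ ∣ ∁ p ∣ → ∣ p ∣ ≤ n ∸ k
≤∣∁p∣⇒∣p∣≤n∸ {k} {n} p k≤ = m+n≤o⇒m≤o∸n ∣ p ∣ (subst (_≤ n) (+-comm k ∣ p ∣)
  (m≤o∸n⇒m+n≤o k (∣p∣≤n p) (subst (k ≤_) (∣∁p∣≡n∸∣p∣ p) k≤)))

embed : ∀ {k n} (c : ℕ) → c + k ≤ n → Fin k → Fin n
embed c c+k≤n i = inject≤ (c ↑ʳ i) c+k≤n

toℕ-embed : ∀ {k n} c (c+k≤n : c + k ≤ n) i → toℕ (embed c c+k≤n i) ≡ c + toℕ i
toℕ-embed c c+k≤n i = trans (toℕ-inject≤ (c ↑ʳ i) c+k≤n) (toℕ-↑ʳ c i)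

embed-injective : ∀ {k n} c (c+k≤n : c + k ≤ n) → Injective _≡_ _≡_ (embed c c+k≤n)
embed-injective c c+k≤n eq = ↑ʳ-injective c _ _ (inject≤-injective c+k≤n c+k≤n _ _ eq)

interval⊆⇒≤∣p∣ : ∀ {n} (p : Subset n) c k → c + k ≤ n →
                 (∀ i → c ≤ toℕ i → toℕ i < c + k → i ∈ p) → k ≤ ∣ p ∣
interval⊆⇒≤∣p∣ p c k c+k≤n interval⊆p =
  injection-into⇒≤∣p∣ p (embed-injective c c+k≤n) λ i →
    interval⊆p _ (subst (c ≤_) (≡.sym (toℕ-embed c c+k≤n i)) (m≤m+n c (toℕ i)))
                 (subst (_< c + k) (≡.sym (toℕ-embed c c+k≤n i)) (+-monoʳ-< c (toℕ<n i)))

subsetOf : ∀ {n ℓ} {P : Pred (Fin n) ℓ} → Decidable P → Subset n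
subsetOf P? = tabulate (does ∘ P?)

module _ {n ℓ} {P : Pred (Fin n) ℓ} (P? : Decidable P) where

  ∈subsetOf⁺ : ∀ {i} → P i → i ∈ subsetOf P?
  ∈subsetOf⁺ {i} Pi =
    lookup⇒[]= i (subsetOf P?) (trans (lookup∘tabulate (does ∘ P?) i) (dec-true (P? i) Pi))

  ∈subsetOf⁻ : ∀ {i} → i ∈ subsetOf P? → P i
  ∈subsetOf⁻ {i} i∈ with P? i | trans (≡.sym (lookup∘tabulate (does ∘ P?) i)) ([]=⇒lookup i∈)
  ... | yes Pi | _ = Pi
  ... | no _ | ()

twice-suc : ∀ g → suc g + suc g ≡ 2 * g + 2
twice-suc = solve 1 (λ g → (con 1 :+ g) :+ (con 1 :+ g) := con 2 :* g :+ con 2) refl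
  where open +-*-Solver

module _ {n} (G : Graph n) (g : ℕ) {S : Subset n} where

  Rg-cutset⇒2g+2≤∣∁S∣ : IsRgCutset G g S → 2 * g + 2 ≤ ∣ ∁ S ∣
  Rg-cutset⇒2g+2≤∣∁S∣ ((u , v , u∉ , v∉ , ¬u~v) , large) with large u u∉ | large v v∉
  ... | f , f-inj , u~f | h , h-inj , v~h =
    subst (_≤ ∣ ∁ S ∣) (twice-suc g)
      (disjoint-injections⇒+≤∣p∣ (∁ S) f-inj h-inj disjoint
        (λ i → x∉p⇒x∈∁p (reach-target∉ (u~f i))) (λ j → x∉p⇒x∈∁p (reach-target∉ (v~h j))))
    where
    disjoint : ∀ i j → f i ≢ h j
    disjoint i j fi≡hj =
      ¬u~v (reach-trans (u~f i) (subst (λ z → Reach G S z v) (≡.sym fi≡hj) (reach-sym (v~h j))))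

  Rg-cutset-bounded : IsRgCutset G g S → ∣ S ∣ ≤ n ∸ (2 * g) ∸ 2
  Rg-cutset-bounded rg =
    subst (∣ S ∣ ≤_) (≡.sym (∸-+-assoc n (2 * g) 2)) (≤∣∁p∣⇒∣p∣≤n∸ S (Rg-cutset⇒2g+2≤∣∁S∣ rg))

κ-bounds : ∀ {n} (G : Graph n) g → Connected G → HasRgCutset G g →
           ∀ k → IsKappa G g k → 1 ≤ k × k ≤ n ∸ (2 * g) ∸ 2
κ-bounds G g con (S₀ , rg₀) k ((S , (cut , _) , ∣S∣≡k) , minimal) =
  subst (1 ≤_) ∣S∣≡k (nonempty⇒1≤∣p∣ (cutset-nonempty G con cut)) ,
  ≤-trans (minimal S₀ rg₀) (Rg-cutset-bounded G g rg₀)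

-- Vertex i lies in the first clique if toℕ i < m, in the second if m ≤ toℕ i < b, and is a
-- universal vertex (hub) if b ≤ toℕ i.
module TwoCliquesJoin {n} (g b : ℕ) (2g+2≤b : 2 * g + 2 ≤ b) (b<n : b < n) where

  m : ℕ
  m = suc g

  m+m≤b : m + m ≤ b
  m+m≤b = subst (_≤ b) (≡.sym (twice-suc g)) 2g+2≤b

  m<n : m < n
  m<n = ≤-<-trans (≤-trans (m≤m+n m m) m+m≤b) b<n

  Hub : Fin n → Set
  Hub u = b ≤ toℕ u

  SameClique : Fin n → Fin n → Set
  SameClique u v = (toℕ u < m × toℕ v < m) ⊎ (m ≤ toℕ u × m ≤ toℕ v)

  Joined : Fin n → Fin n → Set
  Joined u v = Hub u ⊎ Hub v ⊎ SameClique u v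

  Joined-sym : ∀ {u v} → Joined u v → Joined v u
  Joined-sym (inj₁ hub-u) = inj₂ (inj₁ hub-u)
  Joined-sym (inj₂ (inj₁ hub-v)) = inj₁ hub-v
  Joined-sym (inj₂ (inj₂ (inj₁ (u<m , v<m)))) = inj₂ (inj₂ (inj₁ (v<m , u<m)))
  Joined-sym (inj₂ (inj₂ (inj₂ (m≤u , m≤v)))) = inj₂ (inj₂ (inj₂ (m≤v , m≤u)))

  G : Graph n
  G = record
    { Adj = λ u v → u ≢ v × Joined u v
    ; sym = λ { (u≢v , uv) → (λ v≡u → u≢v (≡.sym v≡u)) , Joined-sym uv }
    ; irrefl = λ { (u≢u , _) → u≢u refl }
    }

  joined⇒reach : ∀ {S u v} → Joined u v → u ∉ S → v ∉ S → Reach G S u v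
  joined⇒reach {u = u} {v} uv u∉ v∉ with u ≟ v
  ... | yes refl = here u∉
  ... | no u≢v = step u∉ (u≢v , uv) (here v∉)

  via-hub : ∀ {S c u v} → Hub c → c ∉ S → u ∉ S → v ∉ S → Reach G S u v
  via-hub hub-c c∉ u∉ v∉ =
    reach-trans (joined⇒reach (inj₂ (inj₁ hub-c)) u∉ c∉) (joined⇒reach (inj₁ hub-c) c∉ v∉)

  connected : Connected G
  connected u v = via-hub {c = fromℕ< b<n} (≤-reflexive (≡.sym (toℕ-fromℕ< b<n))) ∉⊥ ∉⊥ ∉⊥

  hubs : Subset n
  hubs = subsetOf (λ i → b ≤? toℕ i)

  hub∈hubs : ∀ {i} → Hub i → i ∈ hubs
  hub∈hubs = ∈subsetOf⁺ (λ i → b ≤? toℕ i)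

  ∈hubs⇒hub : ∀ {i} → i ∈ hubs → Hub i
  ∈hubs⇒hub = ∈subsetOf⁻ (λ i → b ≤? toℕ i)

  low∉hubs : ∀ {i} → toℕ i < b → i ∉ hubs
  low∉hubs i<b i∈ = <⇒≱ i<b (∈hubs⇒hub i∈)

  ∉hubs⇒low : ∀ {i} → i ∉ hubs → toℕ i < b
  ∉hubs⇒low i∉ = ≰⇒> (i∉ ∘ hub∈hubs)

  b+[n∸b]≡n : b + (n ∸ b) ≡ n
  b+[n∸b]≡n = m+[n∸m]≡n (<⇒≤ b<n)

  ∣hubs∣≡n∸b : ∣ hubs ∣ ≡ n ∸ b
  ∣hubs∣≡n∸b = ≤-antisym
    (≤∣∁p∣⇒∣p∣≤n∸ hubs
      (interval⊆⇒≤∣p∣ (∁ hubs) 0 b (<⇒≤ b<n) λ _ _ i<b → x∉p⇒x∈∁p (low∉hubs i<b)))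
    (interval⊆⇒≤∣p∣ hubs b (n ∸ b) (≤-reflexive b+[n∸b]≡n) λ _ b≤i _ → hub∈hubs b≤i)

  hubs⊆cutset : ∀ {S} → IsCutset G S → hubs ⊆ S
  hubs⊆cutset {S} (u , v , u∉ , v∉ , ¬u~v) {c} c∈ with c ∈? S
  ... | yes c∈S = c∈S
  ... | no c∉S = contradiction (via-hub (∈hubs⇒hub c∈) c∉S u∉ v∉) ¬u~v

  low-closed : ∀ {u v} → Reach G hubs u v → toℕ u < m → toℕ v < m
  low-closed (here _) u<m = u<m
  low-closed (step u∉ (_ , inj₁ hub-u) _) _ = contradiction hub-u (<⇒≱ (∉hubs⇒low u∉))
  low-closed (step _ (_ , inj₂ (inj₁ hub-w)) r) _ =
    contradiction hub-w (<⇒≱ (∉hubs⇒low (reach-source∉ r)))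
  low-closed (step _ (_ , inj₂ (inj₂ (inj₁ (_ , w<m)))) r) _ = low-closed r w<m
  low-closed (step _ (_ , inj₂ (inj₂ (inj₂ (m≤u , _)))) _) u<m = contradiction m≤u (<⇒≱ u<m)

  hubs-cutset : IsCutset G hubs
  hubs-cutset = low , high , low∉hubs (<-trans low<m m<b) , low∉hubs high<b
              , λ low~high → <-irrefl (toℕ-fromℕ< m<n) (low-closed low~high low<m)
    where
    low high : Fin n
    low = fromℕ< (≤-<-trans z≤n m<n)
    high = fromℕ< m<n
    m<b : m < b
    m<b = <-≤-trans (m<m+n m z<s) m+m≤b
    low<m : toℕ low < m
    low<m = subst (_< m) (≡.sym (toℕ-fromℕ< _)) z<s
    high<b : toℕ high < b
    high<b = subst (_< b) (≡.sym (toℕ-fromℕ< m<n)) m<b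

  module _ {v} (v∉ : v ∉ hubs) where

    clique-component : ∀ c → c + m ≤ b →
      (∀ i → c ≤ toℕ i → toℕ i < c + m → SameClique v i) → ComponentAtLeast G hubs v m
    clique-component c c+m≤b same =
      f , embed-injective c c+m≤n , λ i → joined⇒reach (inj₂ (inj₂ (same-f i))) v∉ (f∉ i)
      where
      c+m≤n : c + m ≤ n
      c+m≤n = ≤-trans c+m≤b (<⇒≤ b<n)
      f : Fin m → Fin n
      f = embed c c+m≤n
      f<c+m : ∀ i → toℕ (f i) < c + m
      f<c+m i = subst (_< c + m) (≡.sym (toℕ-embed c c+m≤n i)) (+-monoʳ-< c (toℕ<n i))
      same-f : ∀ i → SameClique v (f i)
      same-f i = same (f i) (subst (c ≤_) (≡.sym (toℕ-embed c c+m≤n i)) (m≤m+n c (toℕ i))) (f<c+m i)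
      f∉ : ∀ i → f i ∉ hubs
      f∉ i = low∉hubs (<-≤-trans (f<c+m i) c+m≤b)

    component-large : ComponentAtLeast G hubs v m
    component-large with toℕ v <? m
    ... | yes v<m = clique-component 0 (≤-trans (m≤m+n m m) m+m≤b) λ _ _ i<m → inj₁ (v<m , i<m)
    ... | no v≮m = clique-component m m+m≤b λ _ m≤i _ → inj₂ (≮⇒≥ v≮m , m≤i)

  κ≡n∸b : IsKappa G g (n ∸ b)
  κ≡n∸b = (hubs , (hubs-cutset , λ _ → component-large) , ∣hubs∣≡n∸b)
        , λ S (cut , _) → subst (_≤ ∣ S ∣) ∣hubs∣≡n∸b (p⊆q⇒∣p∣≤∣q∣ (hubs⊆cutset cut))

ConnectedWithκ : (n g k : ℕ) → Set₁
ConnectedWithκ n g k = Σ (Graph n) λ G → Connected G × IsKappa G g k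

two-cliques-join : ∀ {n} g b → 2 * g + 2 ≤ b → b < n → ConnectedWithκ n g (n ∸ b)
two-cliques-join g b 2g+2≤b b<n = G , connected , κ≡n∸b
  where open TwoCliquesJoin g b 2g+2≤b b<n

corollary3p1 : (n g : ℕ) → 2 * g + 3 ≤ n →
    ((G : Graph n) → Connected G → HasRgCutset G g →
      ∀ k → IsKappa G g k → 1 ≤ k × k ≤ n ∸ (2 * g) ∸ 2)
    × (Σ (Graph n) λ G₁ → Connected G₁ × IsKappa G₁ g 1)
    × (Σ (Graph n) λ G₂ → Connected G₂ × IsKappa G₂ g (n ∸ (2 * g) ∸ 2))
corollary3p1 n g 2g+3≤n = (λ G → κ-bounds G g) , κ-one , κ-max
  where
  1≤n : 1 ≤ n
  1≤n = ≤-trans (s≤s z≤n) (≤-trans (m≤n+m 3 (2 * g)) 2g+3≤n)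
  2g+2≤n∸1 : 2 * g + 2 ≤ n ∸ 1
  2g+2≤n∸1 = m+n≤o⇒m≤o∸n (2 * g + 2) (subst (_≤ n) (≡.sym (+-assoc (2 * g) 2 1)) 2g+3≤n)
  κ-one : ConnectedWithκ n g 1
  κ-one = subst (ConnectedWithκ n g) (m∸[m∸n]≡n 1≤n)
            (two-cliques-join g (n ∸ 1) 2g+2≤n∸1 (∸-monoʳ-< z<s 1≤n))
  κ-max : ConnectedWithκ n g (n ∸ (2 * g) ∸ 2)
  κ-max = subst (ConnectedWithκ n g) (≡.sym (∸-+-assoc n (2 * g) 2))
            (two-cliques-join g (2 * g + 2) ≤-refl (subst (_≤ n) (+-suc (2 * g) 2) 2g+3≤n))
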